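{- There exists $\beta<0$ such that \[ \ln p(n,3) \le \frac{1}{n-2}\binom{n}{3}\ln\bigl(\mathrm{e}^{1+\beta} n + o(n)\bigr) \qquad\text{as } n\to\infty. \]
   Context: A matroid of rank $r$ is paving if every set of fewer than $r$ elements is independent. $p(n,3)$ is the number of paving matroids of rank $3$ on the ground set $[n]=\{1,\dots,n\}$. -}

module Defs where

open import Data.Nat using (ℕ; zero; suc; _+_; _*_; _≤ᵇ_; _≡ᵇ_)
open import Data.Bool using (Bool; true; false; _∧_; _∨_; not)
import Data.Bool
open import Data.List using (List; []; _∷_; map; _++_; length; filter; allFin)
open import Data.Bool.ListAction using (all; any)
open import Data.Vec using (Vec; []; _∷_; lookup)
open import Data.Fin using (Fin)
open import Data.Fin.Subset using (Subset; ∣_∣; _∪_; ⁅_⁆)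
open import Data.Bool using (T?)
open import Relation.Unary using (Decidable)

eqSub : ∀ {n} → Subset n → Subset n → Bool
eqSub [] [] = true
eqSub (true ∷ xs) (true ∷ ys) = eqSub xs ys
eqSub (false ∷ xs) (false ∷ ys) = eqSub xs ys
eqSub (_ ∷ _) (_ ∷ _) = false

subB : ∀ {n} → Subset n → Subset n → Bool
subB [] [] = true
subB (true ∷ xs) (false ∷ ys) = false
subB (_ ∷ xs) (_ ∷ ys) = subB xs ys

memB : ∀ {n} → Subset n → List (Subset n) → Bool
memB A F = any (eqSub A) F

allSubsets : (n : ℕ) → List (Subset n)
allSubsets zero = [] ∷ []
allSubsets (suc n) = map (true ∷_) (allSubsets n) ++ map (false ∷_) (allSubsets n)

-- all sublists of a list: for a duplicate-free list these are exactly its subsets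
sublists : ∀ {a} {A : Set a} → List A → List (List A)
sublists [] = [] ∷ []
sublists (x ∷ xs) = map (x ∷_) (sublists xs) ++ sublists xs

emptySet : (n : ℕ) → Subset n
emptySet zero = []
emptySet (suc n) = false ∷ emptySet n

hereditaryB : ∀ {n} → List (Subset n) → Bool
hereditaryB {n} I = all (λ A → all (λ S → not (subB S A) ∨ memB S I) (allSubsets n)) I

augmentB : ∀ {n} → List (Subset n) → Bool
augmentB {n} I =
  all (λ A → all (λ B →
    not (suc ∣ A ∣ ≤ᵇ ∣ B ∣) ∨
    any (λ x → lookup B x ∧ not (lookup A x) ∧ memB (A ∪ ⁅ x ⁆) I) (allFin n)) I) I

isMatroidB : ∀ {n} → List (Subset n) → Bool
isMatroidB {n} I = memB (emptySet n) I ∧ hereditaryB I ∧ augmentB I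

rank3B : ∀ {n} → List (Subset n) → Bool
rank3B I = all (λ A → ∣ A ∣ ≤ᵇ 3) I ∧ any (λ A → ∣ A ∣ ≡ᵇ 3) I

paving3B : ∀ {n} → List (Subset n) → Bool
paving3B {n} I = all (λ A → not (∣ A ∣ ≤ᵇ 2) ∨ memB A I) (allSubsets n)

isPavingRank3B : ∀ {n} → List (Subset n) → Bool
isPavingRank3B I = isMatroidB I ∧ rank3B I ∧ paving3B I

-- p(n,3): number of paving matroids of rank 3 on [n]
-- (a matroid is identified with its family of independent sets)
p3 : ℕ → ℕ
p3 n = length (filter (λ I → T? (isPavingRank3B I)) (sublists (allSubsets n)))

-- eNum K = Σ_{k=0}^{K} K!/k!, so that eNum K / K! = Σ_{k≤K} 1/k!, which
-- increases to e.
eNum : ℕ → ℕ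
eNum zero = 1
eNum (suc K) = suc K * eNum K + 1

{-# OPTIONS --safe #-}

-- A paving matroid of rank 3 on [n] is determined by its dependent 3-sets, and these are the
-- collinear triples of a linear space on [n] (any two points lie on exactly one line), so it
-- suffices to count linear spaces.  Encode such a space line by line: while some pair {a, b} is not
-- yet covered by a chosen line, record the set T of further points on the line through a and b,
-- which covers (∣T∣ + 2) C 2 new pairs.  By induction on the number U of uncovered pairs, at
-- most l ^ U linear spaces are consistent with the lines chosen so far, provided the Kraft-type
-- condition  Σ_{T ⊆ [n]} l ^ (- cost ∣T∣) ≤ 1  holds, where cost 0 = 1 and cost j = 3 j ≤ (j + 2) C 2.
-- The sum equals 1/l + (1 + l⁻³)ⁿ - 1, which Bernoulli's inequality bounds by 1 as soon as
-- 2 l n ≤ (l - 1) l³.  Taking l³ ≈ 5n/2 gives p(n,3) ≤ l ^ (n C 2), hence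
-- p(n,3) ^ (n - 2) ≤ (l³) ^ (n C 3) ≤ (5n/2) ^ (n C 3), and 5/2 < eNum 3 / 3! ≤ e.

module Submission where

open import Defs

open import Algebra.Bundles using (CommutativeMonoid)
open import Data.Bool using (Bool; true; false; T; not; _∧_; _∨_; if_then_else_)
import Data.Bool.Properties as Bool
open import Data.Bool.Properties
  using (T-≡; T-not-≡; T-∧; ∧-conicalˡ; ∧-conicalʳ; ∧-zeroʳ; ∨-conicalˡ; ∨-conicalʳ; ∨-zeroʳ;
         ∨-commutativeMonoid; not-involutive; ⇔→≡)
open import Data.Bool.ListAction using (any; all)
open import Data.Empty using (⊥-elim)
open import Data.Fin using (Fin; zero; suc; _≟_)
open import Data.Fin.Properties using (suc-injective)
open import Data.Fin.Subset using (Subset; ∣_∣; _∪_; ⁅_⁆; inside; outside) renaming (⊥ to ∅; ⊤ to full)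
open import Data.Fin.Subset.Properties using (∪-identityˡ; ∪-identityʳ; ∪-comm; ∪-assoc; ∣⁅x⁆∣≡1; ∣⊤∣≡n; ∣p∣≤n)
open import Data.List using (List; []; _∷_; _++_; map; length; filter; allFin)
import Data.List as List
open import Data.List.Membership.Propositional using (_∈_; _∉_)
open import Data.List.Membership.Propositional.Properties using (∈-map⁺; ∈-map⁻; ∈-++⁺ˡ; ∈-++⁺ʳ; ∈-++⁻; ∈-allFin)
open import Data.List.Properties using (map-++; map-∘; map-cong; length-map; filter-accept)
open import Data.List.Relation.Unary.All using (All; []; _∷_)
import Data.List.Relation.Unary.All as All
import Data.List.Relation.Unary.All.Properties as All
open import Data.List.Relation.Unary.All.Properties using (all⁺)
open import Data.List.Relation.Unary.AllPairs using (AllPairs; []; _∷_)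
import Data.List.Relation.Unary.AllPairs.Properties as AllPairs
open import Data.List.Relation.Unary.Any using (Any; here; there)
import Data.List.Relation.Unary.Any as Any
open import Data.List.Relation.Unary.Any.Properties using (any⁺; any⁻)
open import Data.List.Relation.Unary.Unique.Propositional using (Unique)
import Data.List.Relation.Unary.Unique.Propositional.Properties as Unique
open import Data.Nat using (ℕ; zero; suc; _+_; _*_; _^_; _∸_; _≤_; _<_; z≤n; s≤s; _!; NonZero; _≤ᵇ_)
open import Data.Nat.Combinatorics using (_C_; nC1≡n; nCk+nC[k+1]≡[n+1]C[k+1])
open import Data.Nat.Induction using (<-wellFounded)
open import Data.Nat.ListAction using (sum)
open import Data.Nat.ListAction.Properties using (sum-++)
open import Data.Nat.Properties
  using (*-assoc; *-comm; *-suc; *-identityʳ; *-zeroʳ; *-distribʳ-+; *-distribˡ-+; *-distribˡ-∸;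
         *-mono-≤; *-monoʳ-≤; *-monoˡ-≤; *-cancelʳ-≤; *-cancelˡ-≤; +-comm; +-suc; +-mono-≤; +-monoʳ-≤; +-monoˡ-≤;
         +-cancelʳ-≤; +-∸-assoc; +-∸-comm; m+[n∸m]≡n; m+n∸n≡m; ^-*-assoc; ^-distribˡ-+-*; ^-monoʳ-≤; ^-monoˡ-≤;
         m^n>0; m^n≢0; m<m+n; m<n+m; m≤m*n; m≤m+n; m≤n+m; n≤1+n; n≤0⇒n≡0; ≤-refl; ≤-reflexive; ≤-trans;
         ≤-antisym; <-≤-trans; <⇒≤; <⇒≱; ≮⇒≥; ≰⇒>; ≤ᵇ⇒≤; ≤⇒≤ᵇ; _<?_; module ≤-Reasoning)
open import Data.Nat.Tactic.RingSolver using (solve-∀)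
open import Data.Product using (Σ; Σ-syntax; ∃-syntax; _×_; _,_; proj₁; proj₂)
import Data.Product as Product
open import Data.Sum using (_⊎_; inj₁; inj₂)
open import Data.Vec using (Vec; []; _∷_; lookup; tabulate)
import Data.Vec.Properties as Vec
open import Data.Vec.Properties using (lookup∘tabulate; tabulate∘lookup; tabulate-cong; lookup-zipWith; lookup-replicate)
open import Function using (_∘_; const; mk⇔; Equivalence)
open import Induction.WellFounded using (Acc; acc)
open import Relation.Binary.PropositionalEquality
  using (_≡_; _≢_; refl; sym; trans; cong; cong₂; subst; ≢-sym; module ≡-Reasoning)
open import Relation.Nullary.Decidable using (does; T?; yes; no; dec-true; dec-false; toSum)
open import Relation.Nullary.Negation using (¬_)
open import Relation.Unary using (Decidable)

open import Algebra.Properties.CommutativeSemigroup (CommutativeMonoid.commutativeSemigroup ∨-commutativeMonoid)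
  using () renaming (x∙yz≈y∙xz to ∨-swap)

private variable
  A B : Set
  n k : ℕ
  x y z w : Fin n

count : (A → Bool) → List A → ℕ
count p []       = 0
count p (x ∷ xs) = if p x then suc (count p xs) else count p xs

module _ {p q : A → Bool} where

  count-cong : {xs : List A} → All (λ x → p x ≡ q x) xs → count p xs ≡ count q xs
  count-cong []               = refl
  count-cong (px≡qx ∷ p≡q) rewrite px≡qx | count-cong p≡q = refl

  count-split : (xs : List A) →
    count p xs ≡ count (λ x → p x ∧ q x) xs + count (λ x → p x ∧ not (q x)) xs
  count-split []       = refl
  count-split (x ∷ xs) with p x | q x
  ... | true  | true  = cong suc (count-split xs)
  ... | true  | false = trans (cong suc (count-split xs)) (sym (+-suc _ _))

  ... | false | _     = count-split xs

count-++ : (p : A → Bool) (xs ys : List A) → count p (xs ++ ys) ≡ count p xs + count p ys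
count-++ p []       ys = refl
count-++ p (x ∷ xs) ys with p x
... | true  = cong suc (count-++ p xs ys)
... | false = count-++ p xs ys

count-map : (p : B → Bool) (f : A → B) (xs : List A) → count p (map f xs) ≡ count (p ∘ f) xs
count-map p f []       = refl
count-map p f (x ∷ xs) rewrite count-map p f xs = refl

count-const-false : (xs : List A) → count (const false) xs ≡ 0
count-const-false []       = refl
count-const-false (x ∷ xs) = count-const-false xs

count≡0⇒All : (p : A → Bool) (xs : List A) → count p xs ≡ 0 → All (λ x → p x ≡ false) xs
count≡0⇒All p []       _ = []
count≡0⇒All p (x ∷ xs) c with p x in px
... | false = px ∷ count≡0⇒All p xs c

count>0⇒Any : (p : A → Bool) (xs : List A) → 0 < count p xs → Any (λ x → p x ≡ true) xs
count>0⇒Any p (x ∷ xs) c with p x in px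
... | true  = here px
... | false = there (count>0⇒Any p xs c)

count-tabulate : (p : A → Bool) (f : Fin n → A) → count p (List.tabulate f) ≡ ∣ tabulate (p ∘ f) ∣
count-tabulate {n = zero}  p f = refl
count-tabulate {n = suc n} p f with p (f zero)
... | true  = cong suc (count-tabulate p (f ∘ suc))
... | false = count-tabulate p (f ∘ suc)

true≢false : true ≢ false
true≢false ()

≡-by-lookup : {X Y : Vec A n} → (∀ i → lookup X i ≡ lookup Y i) → X ≡ Y
≡-by-lookup {X = X} {Y} h = trans (sym (tabulate∘lookup X)) (trans (tabulate-cong h) (tabulate∘lookup Y))

card≡count : (X : Subset n) → ∣ X ∣ ≡ count (lookup X) (allFin n)
card≡count X = trans (cong ∣_∣ (sym (tabulate∘lookup X))) (sym (count-tabulate (lookup X) (λ x → x)))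

lookup-∪ : (X Y : Subset n) (z : Fin n) → lookup (X ∪ Y) z ≡ lookup X z ∨ lookup Y z
lookup-∪ X Y z = lookup-zipWith _∨_ z X Y

lookup-⁅⁆ : (x z : Fin n) → lookup ⁅ x ⁆ z ≡ does (z ≟ x)
lookup-⁅⁆ zero    zero    = refl
lookup-⁅⁆ zero    (suc z) = lookup-replicate z outside
lookup-⁅⁆ (suc x) zero    = refl
lookup-⁅⁆ (suc x) (suc z) = lookup-⁅⁆ x z

≢⇒∉⁅⁆ : x ≢ y → lookup ⁅ y ⁆ x ≡ false
≢⇒∉⁅⁆ {x = x} {y} x≢y = trans (lookup-⁅⁆ y x) (dec-false (x ≟ y) x≢y)

∉⁅⁆∪⇒≢ : (Z : Subset n) → lookup (⁅ y ⁆ ∪ Z) x ≡ false → x ≢ y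
∉⁅⁆∪⇒≢ {y = y} {x} Z x∉ x≡y =
  true≢false (trans (sym (trans (lookup-⁅⁆ y x) (dec-true (x ≟ y) x≡y)))
                    (∨-conicalˡ _ _ (trans (sym (lookup-∪ ⁅ y ⁆ Z x)) x∉)))

card-⁅⁆∪ : (x : Fin n) (X : Subset n) → lookup X x ≡ false → ∣ ⁅ x ⁆ ∪ X ∣ ≡ suc ∣ X ∣
card-⁅⁆∪ zero    (false ∷ X) _   = cong (suc ∘ ∣_∣) (∪-identityˡ X)
card-⁅⁆∪ (suc x) (true  ∷ X) x∉X = cong suc (card-⁅⁆∪ x X x∉X)
card-⁅⁆∪ (suc x) (false ∷ X) x∉X = card-⁅⁆∪ x X x∉X

∉pair : x ≢ y → x ≢ z → lookup (⁅ y ⁆ ∪ ⁅ z ⁆) x ≡ false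
∉pair {x = x} {y} {z} x≢y x≢z = trans (lookup-∪ ⁅ y ⁆ ⁅ z ⁆ x) (cong₂ _∨_ (≢⇒∉⁅⁆ x≢y) (≢⇒∉⁅⁆ x≢z))

card-pair : x ≢ y → ∣ ⁅ x ⁆ ∪ ⁅ y ⁆ ∣ ≡ 2
card-pair {x = x} {y} x≢y = trans (card-⁅⁆∪ x ⁅ y ⁆ (≢⇒∉⁅⁆ x≢y)) (cong suc (∣⁅x⁆∣≡1 y))

card≡suc⇒⁅⁆∪ : (X : Subset n) → ∣ X ∣ ≡ suc k →
  Σ[ x ∈ Fin n ] Σ[ Y ∈ Subset n ] X ≡ ⁅ x ⁆ ∪ Y × lookup Y x ≡ false × ∣ Y ∣ ≡ k
card≡suc⇒⁅⁆∪ (true  ∷ X) refl = zero , false ∷ X , cong (true ∷_) (sym (∪-identityˡ X)) , refl , refl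
card≡suc⇒⁅⁆∪ (false ∷ X) c with card≡suc⇒⁅⁆∪ X c
... | x , Y , refl , x∉Y , d = suc x , false ∷ Y , refl , x∉Y , d

card≡0⇒≡∅ : (X : Subset n) → ∣ X ∣ ≡ 0 → X ≡ ∅
card≡0⇒≡∅ []          _ = refl
card≡0⇒≡∅ (false ∷ X) c = cong (false ∷_) (card≡0⇒≡∅ X c)

triple : Fin n → Fin n → Fin n → Subset n
triple x y z = ⁅ x ⁆ ∪ ⁅ y ⁆ ∪ ⁅ z ⁆

∉triple : x ≢ y → x ≢ z → x ≢ w → lookup (triple y z w) x ≡ false
∉triple {x = x} {y} x≢y x≢z x≢w = trans (lookup-∪ ⁅ y ⁆ _ x) (cong₂ _∨_ (≢⇒∉⁅⁆ x≢y) (∉pair x≢z x≢w))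

triple-swap₁₂ : (x y z : Fin n) → triple x y z ≡ triple y x z
triple-swap₁₂ x y z = begin
  ⁅ x ⁆ ∪ ⁅ y ⁆ ∪ ⁅ z ⁆      ≡⟨ ∪-assoc ⁅ x ⁆ ⁅ y ⁆ ⁅ z ⁆ ⟨
  (⁅ x ⁆ ∪ ⁅ y ⁆) ∪ ⁅ z ⁆    ≡⟨ cong (_∪ ⁅ z ⁆) (∪-comm ⁅ x ⁆ ⁅ y ⁆) ⟩
  (⁅ y ⁆ ∪ ⁅ x ⁆) ∪ ⁅ z ⁆    ≡⟨ ∪-assoc ⁅ y ⁆ ⁅ x ⁆ ⁅ z ⁆ ⟩
  ⁅ y ⁆ ∪ ⁅ x ⁆ ∪ ⁅ z ⁆      ∎
  where open ≡-Reasoning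

triple-swap₂₃ : (x y z : Fin n) → triple x y z ≡ triple x z y
triple-swap₂₃ x y z = cong (⁅ x ⁆ ∪_) (∪-comm ⁅ y ⁆ ⁅ z ⁆)

card-triple : x ≢ y → x ≢ z → y ≢ z → ∣ triple x y z ∣ ≡ 3
card-triple {x = x} {y} {z} x≢y x≢z y≢z = begin
  ∣ ⁅ x ⁆ ∪ ⁅ y ⁆ ∪ ⁅ z ⁆ ∣  ≡⟨ card-⁅⁆∪ x _ (∉pair x≢y x≢z) ⟩
  suc ∣ ⁅ y ⁆ ∪ ⁅ z ⁆ ∣      ≡⟨ cong suc (card-⁅⁆∪ y _ (≢⇒∉⁅⁆ y≢z)) ⟩
  suc (suc ∣ ⁅ z ⁆ ∣)        ≡⟨ cong (2 +_) (∣⁅x⁆∣≡1 z) ⟩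
  3                          ∎
  where open ≡-Reasoning

card≡3⇒triple : (X : Subset n) → ∣ X ∣ ≡ 3 →
  Σ[ x ∈ Fin n ] Σ[ y ∈ Fin n ] Σ[ z ∈ Fin n ] x ≢ y × x ≢ z × y ≢ z × X ≡ triple x y z
card≡3⇒triple X c with card≡suc⇒⁅⁆∪ X c
... | x , Y , refl , x∉Y , c₂ with card≡suc⇒⁅⁆∪ Y c₂
... | y , Z , refl , y∉Z , c₁ with card≡suc⇒⁅⁆∪ Z c₁
... | z , W , refl , _ , c₀ with card≡0⇒≡∅ W c₀
... | refl =
  x , y , z , ∉⁅⁆∪⇒≢ _ x∉Y , ∉⁅⁆∪⇒≢ ∅ (∨-conicalʳ _ _ (trans (sym (lookup-∪ ⁅ y ⁆ _ x)) x∉Y)) ,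
  ∉⁅⁆∪⇒≢ ∅ y∉Z , cong (λ S → ⁅ x ⁆ ∪ ⁅ y ⁆ ∪ S) (∪-identityʳ ⁅ z ⁆)

allSubsets-complete : (X : Subset n) → X ∈ allSubsets n
allSubsets-complete []          = here refl
allSubsets-complete (true  ∷ X) = ∈-++⁺ˡ (∈-map⁺ _ (allSubsets-complete X))
allSubsets-complete (false ∷ X) = ∈-++⁺ʳ _ (∈-map⁺ _ (allSubsets-complete X))

allSubsets-unique : (n : ℕ) → Unique (allSubsets n)
allSubsets-unique zero    = [] ∷ []
allSubsets-unique (suc n) =
  Unique.++⁺ (Unique.map⁺ Vec.∷-injectiveʳ (allSubsets-unique n))
             (Unique.map⁺ Vec.∷-injectiveʳ (allSubsets-unique n))
             disjoint
  where
    disjoint : ∀ {X} → ¬ (X ∈ map (true ∷_) (allSubsets n) × X ∈ map (false ∷_) (allSubsets n))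
    disjoint (X∈ , X∈′) with ∈-map⁻ (true ∷_) X∈ | ∈-map⁻ (false ∷_) X∈′
    ... | _ , _ , refl | _ , _ , ()

pairs : (n : ℕ) → List (Fin n × Fin n)
pairs zero    = []
pairs (suc n) = map (λ y → zero , suc y) (allFin n) ++ map (Product.map suc suc) (pairs n)

pairs-distinct : (n : ℕ) → All (λ p → proj₁ p ≢ proj₂ p) (pairs n)
pairs-distinct zero    = []
pairs-distinct (suc n) =
  All.++⁺ (All.map⁺ (All.universal (λ _ ()) (allFin n)))
          (All.map⁺ (All.map (λ x≢y → x≢y ∘ suc-injective) (pairs-distinct n)))

pairs-complete : x ≢ y → (x , y) ∈ pairs n ⊎ (y , x) ∈ pairs n
pairs-complete {x = zero}  {zero}  x≢y = ⊥-elim (x≢y refl)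
pairs-complete {x = zero}  {suc y} _   = inj₁ (∈-++⁺ˡ (∈-map⁺ _ (∈-allFin y)))
pairs-complete {x = suc x} {zero}  _   = inj₂ (∈-++⁺ˡ (∈-map⁺ _ (∈-allFin x)))
pairs-complete {n = suc n} {x = suc x} {suc y} x≢y with pairs-complete (x≢y ∘ cong suc)
... | inj₁ xy∈ = inj₁ (∈-++⁺ʳ _ (∈-map⁺ _ xy∈))
... | inj₂ yx∈ = inj₂ (∈-++⁺ʳ _ (∈-map⁺ _ yx∈))

contains : Subset n → Fin n × Fin n → Bool
contains L p = lookup L (proj₁ p) ∧ lookup L (proj₂ p)

count-contains : (L : Subset n) → count (contains L) (pairs n) ≡ ∣ L ∣ C 2
count-contains []      = refl
count-contains {suc n} (b ∷ L) = begin
  count (contains (b ∷ L)) (pairs (suc n))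
    ≡⟨ count-++ _ (map (λ y → zero , suc y) (allFin n)) _ ⟩
  count (contains (b ∷ L)) (map (λ y → zero , suc y) (allFin n))
    + count (contains (b ∷ L)) (map (Product.map suc suc) (pairs n))
    ≡⟨ cong₂ _+_ (count-map _ _ (allFin n)) (trans (count-map _ _ (pairs n)) (count-contains L)) ⟩
  count (λ y → b ∧ lookup L y) (allFin n) + ∣ L ∣ C 2
    ≡⟨ first-row b ⟩
  ∣ b ∷ L ∣ C 2 ∎
  where
    open ≡-Reasoning
    first-row : ∀ b → count (λ y → b ∧ lookup L y) (allFin n) + ∣ L ∣ C 2 ≡ ∣ b ∷ L ∣ C 2
    first-row true  = trans (cong (_+ ∣ L ∣ C 2) (trans (sym (card≡count L)) (sym (nC1≡n ∣ L ∣))))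
                            (nCk+nC[k+1]≡[n+1]C[k+1] ∣ L ∣ 1)
    first-row false = cong (_+ ∣ L ∣ C 2) (count-const-false (allFin n))

covered : List (Subset n) → Fin n × Fin n → Bool
covered Ls p = any (λ L → contains L p) Ls

covered⁺ : {p : Fin n × Fin n} {Ls : List (Subset n)} →
  Any (λ M → contains M p ≡ true) Ls → covered Ls p ≡ true
covered⁺ = Equivalence.to T-≡ ∘ any⁺ _ ∘ Any.map (Equivalence.from T-≡)

covered⁻ : {p : Fin n × Fin n} (Ls : List (Subset n)) →
  covered Ls p ≡ true → Any (λ M → contains M p ≡ true) Ls
covered⁻ Ls = Any.map (Equivalence.to T-≡) ∘ any⁻ _ Ls ∘ Equivalence.from T-≡

uncoveredPairs : List (Subset n) → ℕ
uncoveredPairs {n} Ls = count (not ∘ covered Ls) (pairs n)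

uncoveredPairs-[] : (n : ℕ) → uncoveredPairs {n} [] ≡ n C 2
uncoveredPairs-[] n = begin
  count (const true) (pairs n)  ≡⟨ count-cong (All.universal (λ p → sym (contains-full p)) (pairs n)) ⟩
  count (contains full) (pairs n) ≡⟨ count-contains (full {n}) ⟩
  ∣ full {n} ∣ C 2               ≡⟨ cong (_C 2) (∣⊤∣≡n n) ⟩
  n C 2                          ∎
  where
    open ≡-Reasoning
    contains-full : (p : Fin n × Fin n) → contains full p ≡ true
    contains-full p = cong₂ _∧_ (lookup-replicate (proj₁ p) inside) (lookup-replicate (proj₂ p) inside)

uncoveredPairs-∷ : (L : Subset n) (Ls : List (Subset n)) →
  uncoveredPairs Ls ≡ uncoveredPairs (L ∷ Ls) + count (λ p → not (covered Ls p) ∧ contains L p) (pairs n)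
uncoveredPairs-∷ {n} L Ls = begin
  uncoveredPairs Ls
    ≡⟨ count-split {p = not ∘ covered Ls} {q = contains L} (pairs n) ⟩
  newlyCovered + count (λ p → not (covered Ls p) ∧ not (contains L p)) (pairs n)
    ≡⟨ +-comm newlyCovered _ ⟩
  count (λ p → not (covered Ls p) ∧ not (contains L p)) (pairs n) + newlyCovered
    ≡⟨ cong (_+ newlyCovered) (count-cong (All.universal (λ p → deMorgan (covered Ls p) (contains L p)) (pairs n))) ⟩
  uncoveredPairs (L ∷ Ls) + newlyCovered ∎
  where
    open ≡-Reasoning
    newlyCovered : ℕ
    newlyCovered = count (λ p → not (covered Ls p) ∧ contains L p) (pairs n)
    deMorgan : ∀ u v → not u ∧ not v ≡ not (v ∨ u)
    deMorgan true  true  = refl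
    deMorgan true  false = refl
    deMorgan false true  = refl
    deMorgan false false = refl

-- Linear spaces

-- D x y z says that x, y, z are collinear; the values of D on non-distinct triples never matter.
Ternary : ℕ → Set
Ternary n = Fin n → Fin n → Fin n → Bool

record IsLinearSpace (D : Ternary n) : Set where
  field
    sym₁₂    : ∀ x y z → D x y z ≡ D y x z
    sym₂₃    : ∀ x y z → D x y z ≡ D x z y
    exchange : ∀ {a b c d} → a ≢ b → a ≢ c → a ≢ d → b ≢ c → b ≢ d → c ≢ d →
               D a b c ≡ true → D a b d ≡ true → D a c d ≡ true

thirdPoints : Ternary n → Fin n → Fin n → Subset n
thirdPoints D a b = tabulate λ z → not (does (z ≟ a)) ∧ not (does (z ≟ b)) ∧ D a b z

line : Ternary n → Fin n → Fin n → Subset n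
line D a b = ⁅ a ⁆ ∪ ⁅ b ⁆ ∪ thirdPoints D a b

onLine : Ternary n → Fin n → Fin n → Fin n → Bool
onLine D a b z = does (z ≟ a) ∨ does (z ≟ b) ∨ D a b z

module _ (D : Ternary n) where

  lookup-line : ∀ a b z → lookup (line D a b) z ≡ onLine D a b z
  lookup-line a b z = begin
    lookup (line D a b) z
      ≡⟨ lookup-∪ ⁅ a ⁆ _ z ⟩
    lookup ⁅ a ⁆ z ∨ lookup (⁅ b ⁆ ∪ thirdPoints D a b) z
      ≡⟨ cong₂ _∨_ (lookup-⁅⁆ a z)
                   (trans (lookup-∪ ⁅ b ⁆ _ z) (cong₂ _∨_ (lookup-⁅⁆ b z) (lookup∘tabulate _ z))) ⟩
    does (z ≟ a) ∨ does (z ≟ b) ∨ (not (does (z ≟ a)) ∧ not (does (z ≟ b)) ∧ D a b z)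
      ≡⟨ absorb (does (z ≟ a)) (does (z ≟ b)) (D a b z) ⟩
    onLine D a b z ∎
    where
      open ≡-Reasoning
      absorb : ∀ u v w → u ∨ v ∨ (not u ∧ not v ∧ w) ≡ u ∨ v ∨ w
      absorb true  _     _ = refl
      absorb false true  _ = refl
      absorb false false _ = refl

  card-line : ∀ {a b} → a ≢ b → ∣ line D a b ∣ ≡ 2 + ∣ thirdPoints D a b ∣
  card-line {a} {b} a≢b = trans (card-⁅⁆∪ a _ a∉) (cong suc (card-⁅⁆∪ b _ b∉))
    where
      a∉ : lookup (⁅ b ⁆ ∪ thirdPoints D a b) a ≡ false
      a∉ = trans (lookup-∪ ⁅ b ⁆ _ a)
             (cong₂ _∨_ (≢⇒∉⁅⁆ a≢b)
                        (trans (lookup∘tabulate _ a)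
                               (cong (λ t → not t ∧ (not (does (a ≟ b)) ∧ D a b a)) (dec-true (a ≟ a) refl))))
      b∉ : lookup (thirdPoints D a b) b ≡ false
      b∉ = trans (lookup∘tabulate _ b)
             (trans (cong (λ t → not (does (b ≟ a)) ∧ not t ∧ D a b b) (dec-true (b ≟ b) refl)) (∧-zeroʳ _))

  onLine-first : ∀ a b → onLine D a b a ≡ true
  onLine-first a b rewrite dec-true (a ≟ a) refl = refl

  onLine-second : ∀ a b → onLine D a b b ≡ true
  onLine-second a b rewrite dec-true (b ≟ b) refl = ∨-zeroʳ _

  onLine-other : ∀ {a b z} → z ≢ a → z ≢ b → onLine D a b z ≡ D a b z
  onLine-other {a} {b} {z} z≢a z≢b rewrite dec-false (z ≟ a) z≢a | dec-false (z ≟ b) z≢b = refl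

IsLineOf : Ternary n → Subset n → Set
IsLineOf D L = ∀ {x y} → lookup L x ≡ true → lookup L y ≡ true → x ≢ y → line D x y ≡ L

module LinearSpace {D : Ternary n} (isD : IsLinearSpace D) where
  open IsLinearSpace isD

  onLine-sym : ∀ a b z → onLine D a b z ≡ onLine D b a z
  onLine-sym a b z rewrite sym₁₂ a b z = ∨-swap (does (z ≟ a)) (does (z ≟ b)) (D b a z)

  onLine-replace : ∀ {a b c} → a ≢ b → c ≢ a → onLine D a b c ≡ true →
                   ∀ z → onLine D a c z ≡ onLine D a b z
  onLine-replace {a} {b} {c} a≢b c≢a c∈ab z with toSum (c ≟ b)
  ... | inj₁ refl = refl
  ... | inj₂ c≢b with toSum (z ≟ a)
  ...   | inj₁ refl = trans (onLine-first D z c) (sym (onLine-first D z b))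
  ...   | inj₂ z≢a with toSum (z ≟ c)
  ...     | inj₁ refl = trans (onLine-second D a z) (sym c∈ab)
  ...     | inj₂ z≢c with toSum (z ≟ b)
  ...       | inj₁ refl = begin
    onLine D a c z   ≡⟨ onLine-other D z≢a (≢-sym c≢b) ⟩
    D a c z          ≡⟨ sym₂₃ a c z ⟩
    D a z c          ≡⟨ onLine-other D c≢a c≢b ⟨
    onLine D a z c   ≡⟨ c∈ab ⟩
    true             ≡⟨ onLine-second D a z ⟨
    onLine D a z z   ∎
    where open ≡-Reasoning
  ...       | inj₂ z≢b = begin
    onLine D a c z   ≡⟨ onLine-other D z≢a z≢c ⟩
    D a c z          ≡⟨ ⇔→≡ (mk⇔ Dacz⇒Dabz Dabz⇒Dacz) ⟩
    D a b z          ≡⟨ onLine-other D z≢a z≢b ⟨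
    onLine D a b z   ∎
    where
      open ≡-Reasoning
      Dabc : D a b c ≡ true
      Dabc = trans (sym (onLine-other D c≢a c≢b)) c∈ab
      Dacz⇒Dabz : D a c z ≡ true → D a b z ≡ true
      Dacz⇒Dabz = exchange (≢-sym c≢a) a≢b (≢-sym z≢a) c≢b (≢-sym z≢c) (≢-sym z≢b)
                           (trans (sym₂₃ a c b) Dabc)
      Dabz⇒Dacz : D a b z ≡ true → D a c z ≡ true
      Dabz⇒Dacz = exchange a≢b (≢-sym c≢a) (≢-sym z≢a) (≢-sym c≢b) (≢-sym z≢b) (≢-sym z≢c) Dabc

  line-through : ∀ {a b x y} → a ≢ b → onLine D a b x ≡ true → onLine D a b y ≡ true → x ≢ y →
                 line D x y ≡ line D a b
  line-through {a} {b} {x} {y} a≢b x∈ab y∈ab x≢y = ≡-by-lookup λ z → begin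
    lookup (line D x y) z  ≡⟨ lookup-line D x y z ⟩
    onLine D x y z         ≡⟨ onLine-through z ⟩
    onLine D a b z         ≡⟨ lookup-line D a b z ⟨
    lookup (line D a b) z  ∎
    where
      open ≡-Reasoning
      onLine-through : ∀ z → onLine D x y z ≡ onLine D a b z
      onLine-through z with toSum (x ≟ a)
      ... | inj₁ refl = onLine-replace a≢b (≢-sym x≢y) y∈ab z
      ... | inj₂ x≢a = begin
        onLine D x y z  ≡⟨ onLine-replace x≢a (≢-sym x≢y) y∈xa z ⟩
        onLine D x a z  ≡⟨ onLine-sym a x z ⟨
        onLine D a x z  ≡⟨ onLine-replace a≢b x≢a x∈ab z ⟩
        onLine D a b z  ∎
        where
          y∈xa : onLine D x a y ≡ true
          y∈xa = trans (sym (onLine-sym a x y)) (trans (onLine-replace a≢b x≢a x∈ab y) y∈ab)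

  line-sym : ∀ a b → line D a b ≡ line D b a
  line-sym a b = ≡-by-lookup λ z → trans (lookup-line D a b z) (trans (onLine-sym a b z) (sym (lookup-line D b a z)))

  line-isLineOf : ∀ {a b} → a ≢ b → IsLineOf D (line D a b)
  line-isLineOf {a} {b} a≢b {x} {y} x∈ y∈ =
    line-through a≢b (trans (sym (lookup-line D a b x)) x∈) (trans (sym (lookup-line D a b y)) y∈)

  contains-defining-pair : ∀ a b → contains (line D a b) (a , b) ≡ true
  contains-defining-pair a b =
    cong₂ _∧_ (trans (lookup-line D a b a) (onLine-first D a b)) (trans (lookup-line D a b b) (onLine-second D a b))

  module _ {Ls : List (Subset n)} (lines : All (IsLineOf D) Ls) {a b : Fin n} (a≢b : a ≢ b)
           (ab-uncovered : covered Ls (a , b) ≡ false) where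

    uncovered-within-line : {p : Fin n × Fin n} → proj₁ p ≢ proj₂ p →
      contains (line D a b) p ≡ true → covered Ls p ≡ false
    uncovered-within-line {p} x≢y p∈ab with covered Ls p in p-covered
    ... | false = refl
    ... | true  = ⊥-elim (true≢false (trans (sym (covered⁺ (move lines (covered⁻ Ls p-covered)))) ab-uncovered))
      where
        line≡ : ∀ {M} → IsLineOf D M → contains M p ≡ true → line D a b ≡ M
        line≡ M-line p∈M = trans (sym (line-isLineOf a≢b (∧-conicalˡ _ _ p∈ab) (∧-conicalʳ _ _ p∈ab) x≢y))
                                 (M-line (∧-conicalˡ _ _ p∈M) (∧-conicalʳ _ _ p∈M) x≢y)
        move : ∀ {Ms} → All (IsLineOf D) Ms →
               Any (λ M → contains M p ≡ true) Ms → Any (λ M → contains M (a , b) ≡ true) Ms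
        move (M-line ∷ _)     (here p∈M) =
          here (subst (λ M → contains M (a , b) ≡ true) (line≡ M-line p∈M) (contains-defining-pair a b))
        move (_      ∷ lines) (there q)  = there (move lines q)

    uncoveredPairs-line : uncoveredPairs Ls ≡ uncoveredPairs (line D a b ∷ Ls) + ∣ line D a b ∣ C 2
    uncoveredPairs-line = trans (uncoveredPairs-∷ (line D a b) Ls)
      (cong (uncoveredPairs (line D a b ∷ Ls) +_)
            (trans (count-cong (All.map only-contains (pairs-distinct n))) (count-contains (line D a b))))
      where
        only-contains : {p : Fin n × Fin n} → proj₁ p ≢ proj₂ p →
          not (covered Ls p) ∧ contains (line D a b) p ≡ contains (line D a b) p
        only-contains {p} x≢y with contains (line D a b) p in p∈ab
        ... | true  rewrite uncovered-within-line x≢y p∈ab = refl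
        ... | false = ∧-zeroʳ _

module _ {D D′ : Ternary n} (isD : IsLinearSpace D) (isD′ : IsLinearSpace D′)
         {Ls : List (Subset n)} (lines : All (IsLineOf D) Ls) (lines′ : All (IsLineOf D′) Ls) where

  covered⇒line≡ : covered Ls (x , y) ≡ true → x ≢ y → line D x y ≡ line D′ x y
  covered⇒line≡ {x} {y} xy-covered x≢y with All.lookupAny (All.zip (lines , lines′)) (covered⁻ Ls xy-covered)
  ... | (M-line , M-line′) , xy∈M =
    trans (M-line  (∧-conicalˡ _ _ xy∈M) (∧-conicalʳ _ _ xy∈M) x≢y)
          (sym (M-line′ (∧-conicalˡ _ _ xy∈M) (∧-conicalʳ _ _ xy∈M) x≢y))

  agree-when-all-covered : uncoveredPairs Ls ≡ 0 → x ≢ y → x ≢ z → y ≢ z → D x y z ≡ D′ x y z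
  agree-when-all-covered {x} {y} {z} none x≢y x≢z y≢z = begin
    D x y z                ≡⟨ onLine-other D (≢-sym x≢z) (≢-sym y≢z) ⟨
    onLine D x y z         ≡⟨ lookup-line D x y z ⟨
    lookup (line D x y) z  ≡⟨ cong (λ L → lookup L z) same-line ⟩
    lookup (line D′ x y) z ≡⟨ lookup-line D′ x y z ⟩
    onLine D′ x y z        ≡⟨ onLine-other D′ (≢-sym x≢z) (≢-sym y≢z) ⟩
    D′ x y z               ∎
    where
      open ≡-Reasoning
      all-covered : {p : Fin n × Fin n} → p ∈ pairs n → covered Ls p ≡ true
      all-covered p∈ = trans (sym (not-involutive _)) (cong not (All.lookup (count≡0⇒All _ (pairs n) none) p∈))
      same-line : line D x y ≡ line D′ x y
      same-line with pairs-complete x≢y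
      ... | inj₁ xy∈ = covered⇒line≡ (all-covered xy∈) x≢y
      ... | inj₂ yx∈ = begin
        line D x y   ≡⟨ LinearSpace.line-sym isD x y ⟩
        line D y x   ≡⟨ covered⇒line≡ (all-covered yx∈) (≢-sym x≢y) ⟩
        line D′ y x  ≡⟨ LinearSpace.line-sym isD′ x y ⟨
        line D′ x y  ∎

sum-map-mono : {f g : A → ℕ} {xs : List A} → All (λ x → f x ≤ g x) xs → sum (map f xs) ≤ sum (map g xs)
sum-map-mono []            = z≤n
sum-map-mono (fx≤gx ∷ f≤g) = +-mono-≤ fx≤gx (sum-map-mono f≤g)

sum-map-*ˡ : (c : ℕ) (f : A → ℕ) (xs : List A) → sum (map (λ x → c * f x) xs) ≡ c * sum (map f xs)
sum-map-*ˡ c f []       = sym (*-zeroʳ c)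
sum-map-*ˡ c f (x ∷ xs) = trans (cong (c * f x +_) (sum-map-*ˡ c f xs)) (sym (*-distribˡ-+ c (f x) _))

sum-map-*ʳ : (c : ℕ) (f : A → ℕ) (xs : List A) → sum (map (λ x → f x * c) xs) ≡ sum (map f xs) * c
sum-map-*ʳ c f []       = refl
sum-map-*ʳ c f (x ∷ xs) = trans (cong (f x * c +_) (sum-map-*ʳ c f xs)) (sym (*-distribʳ-+ c (f x) _))

length-filter-∷ : {P : A → Set} (P? : Decidable P) (x : A) (xs : List A) →
  length (filter P? xs) ≤ length (filter P? (x ∷ xs))
length-filter-∷ P? x xs with does (P? x)
... | true  = n≤1+n _
... | false = ≤-refl

module _ {Q : B → A → Set} (Q? : ∀ T → Decidable (Q T)) where

  classSizes : List B → List A → ℕ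
  classSizes Ts xs = sum (map (λ T → length (filter (Q? T) xs)) Ts)

  classSizes-mono : (Ts : List B) (x : A) (xs : List A) → classSizes Ts xs ≤ classSizes Ts (x ∷ xs)
  classSizes-mono Ts x xs = sum-map-mono (All.universal (λ T → length-filter-∷ (Q? T) x xs) Ts)

  classSizes-∷ : {Ts : List B} {x : A} (xs : List A) → Any (λ T → Q T x) Ts →
    suc (classSizes Ts xs) ≤ classSizes Ts (x ∷ xs)
  classSizes-∷ {T ∷ Ts} xs (here q) rewrite filter-accept (Q? T) {xs = xs} q =
    s≤s (+-monoʳ-≤ _ (classSizes-mono Ts _ xs))
  classSizes-∷ {T ∷ Ts} {x} xs (there i) = begin
    suc (length (filter (Q? T) xs) + classSizes Ts xs)  ≡⟨ +-suc _ _ ⟨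
    length (filter (Q? T) xs) + suc (classSizes Ts xs)
      ≤⟨ +-mono-≤ (length-filter-∷ (Q? T) x xs) (classSizes-∷ xs i) ⟩
    classSizes (T ∷ Ts) (x ∷ xs)                         ∎
    where open ≤-Reasoning

  length≤classSizes : (Ts : List B) {xs : List A} → All (λ x → Any (λ T → Q T x) Ts) xs →
                      length xs ≤ classSizes Ts xs
  length≤classSizes Ts []                = z≤n
  length≤classSizes Ts (x∈Ts ∷ xs∈Ts) = ≤-trans (s≤s (length≤classSizes Ts xs∈Ts)) (classSizes-∷ _ x∈Ts)

kraft-inequality : {Ts : List B} (c w : B → ℕ) {M X : ℕ} .{{_ : NonZero M}} →
  All (λ T → c T * M ≤ X * w T) Ts → sum (map w Ts) ≤ M → sum (map c Ts) ≤ X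
kraft-inequality {Ts = Ts} c w {M} {X} per-class total = *-cancelʳ-≤ _ _ M (begin
  sum (map c Ts) * M            ≡⟨ sum-map-*ʳ M c Ts ⟨
  sum (map (λ T → c T * M) Ts)  ≤⟨ sum-map-mono per-class ⟩
  sum (map (λ T → X * w T) Ts)  ≡⟨ sum-map-*ˡ X w Ts ⟩
  X * sum (map w Ts)            ≤⟨ *-monoʳ-≤ X total ⟩
  X * M                         ∎)
  where open ≤-Reasoning

-- Counting linear spaces

-- A line through an uncovered pair and j further points covers (2 + j) C 2 pairs;
-- cost j is a lower bound for that number whose Kraft sum has a closed form.
cost : ℕ → ℕ
cost zero    = 1
cost (suc j) = 3 * suc j

0<cost : ∀ j → 0 < cost j
0<cost zero    = s≤s z≤n
0<cost (suc j) = s≤s z≤n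

cost≤[2+j]C2 : ∀ j → cost j ≤ (2 + j) C 2
cost≤[2+j]C2 zero          = ≤-refl
cost≤[2+j]C2 (suc zero)    = ≤-refl
cost≤[2+j]C2 (suc (suc j)) = begin
  3 * (2 + j)             ≡⟨ *-suc 3 (suc j) ⟩
  3 + 3 * suc j           ≤⟨ +-mono-≤ (m≤m+n 3 j) (cost≤[2+j]C2 (suc j)) ⟩
  (3 + j) + (3 + j) C 2   ≡⟨ cong (_+ (3 + j) C 2) (nC1≡n (3 + j)) ⟨
  (3 + j) C 1 + (3 + j) C 2 ≡⟨ nCk+nC[k+1]≡[n+1]C[k+1] (3 + j) 1 ⟩
  (4 + j) C 2             ∎
  where open ≤-Reasoning

cost≤3n+1 : ∀ {j n} → j ≤ n → cost j ≤ 3 * n + 1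
cost≤3n+1 {zero}  _   = m≤n+m 1 _
cost≤3n+1 {suc j} j≤n = ≤-trans (*-monoʳ-≤ 3 j≤n) (m≤m+n _ 1)

-- kraftSum l n ≤ l ^ (3 * n + 1) is the Kraft condition Σ_T l ^ (- cost ∣T∣) ≤ 1, scaled to ℕ.
kraftSum : ℕ → ℕ → ℕ
kraftSum l n = sum (map (λ T → l ^ (3 * n + 1 ∸ cost ∣ T ∣)) (allSubsets n))

Differ : Ternary n → Ternary n → Set
Differ {n} D D′ = ∃[ x ] ∃[ y ] ∃[ z ] x ≢ y × x ≢ z × y ≢ z × D x y z ≢ D′ x y z

class-cost-bound : ∀ {l c a d e K} .{{_ : NonZero l}} → c ≤ l ^ a → d ≤ e → d ≤ K →
  c * l ^ K ≤ l ^ (a + e) * l ^ (K ∸ d)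
class-cost-bound {l} {c} {a} {d} {e} {K} c≤ d≤e d≤K = begin
  c * l ^ K                      ≡⟨ cong (λ m → c * l ^ m) (m+[n∸m]≡n d≤K) ⟨
  c * l ^ (d + (K ∸ d))          ≡⟨ cong (c *_) (^-distribˡ-+-* l d (K ∸ d)) ⟩
  c * (l ^ d * l ^ (K ∸ d))      ≡⟨ *-assoc c _ _ ⟨
  c * l ^ d * l ^ (K ∸ d)        ≤⟨ *-monoˡ-≤ _ (*-mono-≤ c≤ (^-monoʳ-≤ l d≤e)) ⟩
  l ^ a * l ^ e * l ^ (K ∸ d)    ≡⟨ cong (_* l ^ (K ∸ d)) (^-distribˡ-+-* l a e) ⟨
  l ^ (a + e) * l ^ (K ∸ d)      ∎
  where open ≤-Reasoning

module Counting (l : ℕ) .{{_ : NonZero l}} {n : ℕ} (kraftSum≤ : kraftSum l n ≤ l ^ (3 * n + 1)) where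

  Consistent : List (Subset n) → Ternary n → Set
  Consistent Ls D = IsLinearSpace D × All (IsLineOf D) Ls

  Bound : List (Subset n) → Set
  Bound Ls = (ds : List (Ternary n)) → All (Consistent Ls) ds → AllPairs Differ ds → length ds ≤ l ^ uncoveredPairs Ls

  at-most-one : {Ls : List (Subset n)} → uncoveredPairs Ls ≡ 0 →
    (ds : List (Ternary n)) → All (Consistent Ls) ds → AllPairs Differ ds → length ds ≤ 1
  at-most-one _    []           _ _ = z≤n
  at-most-one _    (_ ∷ [])     _ _ = ≤-refl
  at-most-one none (_ ∷ _ ∷ _) ((isD , lines) ∷ (isD′ , lines′) ∷ _)
              (((_ , _ , _ , x≢y , x≢z , y≢z , differ) ∷ _) ∷ _) =
    ⊥-elim (differ (agree-when-all-covered isD isD′ lines lines′ none x≢y x≢z y≢z))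

  module Branch (Ls : List (Subset n)) {a b : Fin n} (a≢b : a ≢ b) (ab-uncovered : covered Ls (a , b) ≡ false)
                (ih : ∀ Ls′ → uncoveredPairs Ls′ < uncoveredPairs Ls → Bound Ls′) where

    InClass : Subset n → Ternary n → Set
    InClass T D = thirdPoints D a b ≡ T

    InClass? : ∀ T → Decidable (InClass T)
    InClass? T D = Vec.≡-dec Bool._≟_ (thirdPoints D a b) T

    class-bound : (T : Subset n) (ds : List (Ternary n)) →
      All (InClass T) ds → All (Consistent Ls) ds → AllPairs Differ ds →
      length ds * l ^ (3 * n + 1) ≤ l ^ uncoveredPairs Ls * l ^ (3 * n + 1 ∸ cost ∣ T ∣)
    class-bound T []       _             _                       _      = z≤n
    class-bound T (D ∷ ds) in-T@(refl ∷ _) consistent@((isD , lines) ∷ _) differ =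
      subst (λ m → length (D ∷ ds) * l ^ (3 * n + 1) ≤ l ^ m * l ^ (3 * n + 1 ∸ cost ∣ T ∣)) (sym uncovered-split)
        (class-cost-bound {a = uncoveredPairs Ls′}
                          (ih Ls′ fewer (D ∷ ds) (All.zipWith extend (in-T , consistent)) differ)
                          (cost≤[2+j]C2 ∣ T ∣) (cost≤3n+1 (∣p∣≤n T)))
      where
        Ls′ : List (Subset n)
        Ls′ = line D a b ∷ Ls
        uncovered-split : uncoveredPairs Ls ≡ uncoveredPairs Ls′ + (2 + ∣ T ∣) C 2
        uncovered-split = trans (LinearSpace.uncoveredPairs-line isD lines a≢b ab-uncovered)
                                (cong (λ m → uncoveredPairs Ls′ + m C 2) (card-line D a≢b))
        fewer : uncoveredPairs Ls′ < uncoveredPairs Ls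
        fewer = subst (uncoveredPairs Ls′ <_) (sym uncovered-split)
                      (m<m+n (uncoveredPairs Ls′) (<-≤-trans (0<cost ∣ T ∣) (cost≤[2+j]C2 ∣ T ∣)))
        extend : ∀ {D′} → InClass T D′ × Consistent Ls D′ → Consistent Ls′ D′
        extend {D′} (same , isD′ , lines′) =
          isD′ , subst (IsLineOf D′) (cong (λ S → ⁅ a ⁆ ∪ ⁅ b ⁆ ∪ S) same) (LinearSpace.line-isLineOf isD′ a≢b)
               ∷ lines′

    bound : Bound Ls
    bound ds consistent differ = ≤-trans
      (length≤classSizes InClass? (allSubsets n) (All.universal (λ D → allSubsets-complete (thirdPoints D a b)) ds))
      (kraft-inequality (λ T → length (filter (InClass? T) ds)) (λ T → l ^ (3 * n + 1 ∸ cost ∣ T ∣))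
                        {{m^n≢0 l (3 * n + 1)}} (All.universal per-class (allSubsets n)) kraftSum≤)
      where
        per-class : ∀ T → length (filter (InClass? T) ds) * l ^ (3 * n + 1) ≤
                          l ^ uncoveredPairs Ls * l ^ (3 * n + 1 ∸ cost ∣ T ∣)
        per-class T = class-bound T (filter (InClass? T) ds) (All.all-filter (InClass? T) ds)
                        (All.filter⁺ (InClass? T) consistent) (AllPairs.filter⁺ (InClass? T) differ)

  bound : (Ls : List (Subset n)) → Acc _<_ (uncoveredPairs Ls) → Bound Ls
  bound Ls (acc smaller) ds consistent differ with 0 <? uncoveredPairs Ls
  ... | no  none = ≤-trans (at-most-one (n≤0⇒n≡0 (≮⇒≥ none)) ds consistent differ) (m^n>0 l (uncoveredPairs Ls))
  ... | yes some with All.lookupAny (pairs-distinct n) (count>0⇒Any _ (pairs n) some)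
  ...   | a≢b , ab-uncovered =
    Branch.bound Ls a≢b (trans (sym (not-involutive _)) (cong not ab-uncovered))
                 (λ Ls′ fewer → bound Ls′ (smaller fewer)) ds consistent differ

  linearSpaces-bound : (ds : List (Ternary n)) → All IsLinearSpace ds → AllPairs Differ ds → length ds ≤ l ^ (n C 2)
  linearSpaces-bound ds linear differ = subst (λ m → length ds ≤ l ^ m) (uncoveredPairs-[] n)
    (bound [] (<-wellFounded _) ds (All.map (_, []) linear) differ)

-- The Kraft condition

sum-allSubsets-suc : (f : Subset (suc n) → ℕ) →
  sum (map f (allSubsets (suc n))) ≡
  sum (map (f ∘ (true ∷_)) (allSubsets n)) + sum (map (f ∘ (false ∷_)) (allSubsets n))
sum-allSubsets-suc {n} f = begin
  sum (map f (map (true ∷_) S ++ map (false ∷_) S))             ≡⟨ cong sum (map-++ f (map (true ∷_) S) _) ⟩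
  sum (map f (map (true ∷_) S) ++ map f (map (false ∷_) S))     ≡⟨ sum-++ (map f (map (true ∷_) S)) _ ⟩
  sum (map f (map (true ∷_) S)) + sum (map f (map (false ∷_) S))
    ≡⟨ cong₂ _+_ (cong sum (map-∘ S)) (cong sum (map-∘ S)) ⟨
  sum (map (f ∘ (true ∷_)) S) + sum (map (f ∘ (false ∷_)) S)     ∎
  where
    open ≡-Reasoning
    S : List (Subset n)
    S = allSubsets n

binomial-allSubsets : (x n : ℕ) → sum (map (λ T → x ^ (n ∸ ∣ T ∣)) (allSubsets n)) ≡ suc x ^ n
binomial-allSubsets x zero    = refl
binomial-allSubsets x (suc n) = begin
  sum (map (λ T → x ^ (suc n ∸ ∣ T ∣)) (allSubsets (suc n)))
    ≡⟨ sum-allSubsets-suc {n} (λ T → x ^ (suc n ∸ ∣ T ∣)) ⟩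
  sum (map (λ T → x ^ (n ∸ ∣ T ∣)) S) + sum (map (λ T → x ^ (suc n ∸ ∣ T ∣)) S)
    ≡⟨ cong (sum (map (λ T → x ^ (n ∸ ∣ T ∣)) S) +_)
            (cong sum (map-cong (λ T → cong (x ^_) (+-∸-assoc 1 (∣p∣≤n T))) S)) ⟩
  sum (map (λ T → x ^ (n ∸ ∣ T ∣)) S) + sum (map (λ T → x * x ^ (n ∸ ∣ T ∣)) S)
    ≡⟨ cong₂ _+_ (binomial-allSubsets x n) (trans (sum-map-*ˡ x _ S) (cong (x *_) (binomial-allSubsets x n))) ⟩
  suc x ^ n + x * suc x ^ n
    ∎
  where
    open ≡-Reasoning
    S : List (Subset n)
    S = allSubsets n

kraftWeight : (l n j : ℕ) → ℕ
kraftWeight l n zero    = (l ^ 3) ^ n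
kraftWeight l n (suc j) = l * (l ^ 3) ^ (n ∸ suc j)

l^[3n+1∸cost]≡kraftWeight : ∀ l {n j} → j ≤ n → l ^ (3 * n + 1 ∸ cost j) ≡ kraftWeight l n j
l^[3n+1∸cost]≡kraftWeight l {n} {zero}  _   = trans (cong (l ^_) (m+n∸n≡m (3 * n) 1)) (sym (^-*-assoc l 3 n))
l^[3n+1∸cost]≡kraftWeight l {n} {suc j} j<n = begin
  l ^ (3 * n + 1 ∸ 3 * suc j)       ≡⟨ cong (l ^_) (+-∸-comm 1 (*-monoʳ-≤ 3 j<n)) ⟩
  l ^ (3 * n ∸ 3 * suc j + 1)       ≡⟨ cong (λ m → l ^ (m + 1)) (*-distribˡ-∸ 3 n (suc j)) ⟨
  l ^ (3 * (n ∸ suc j) + 1)         ≡⟨ ^-distribˡ-+-* l (3 * (n ∸ suc j)) 1 ⟩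
  l ^ (3 * (n ∸ suc j)) * (l * 1)   ≡⟨ cong₂ _*_ (^-*-assoc l 3 (n ∸ suc j)) (sym (*-identityʳ l)) ⟨
  (l ^ 3) ^ (n ∸ suc j) * l         ≡⟨ *-comm _ l ⟩
  l * (l ^ 3) ^ (n ∸ suc j)         ∎
  where open ≡-Reasoning

kraftWeight-suc : ∀ l {n j} → j ≤ n → kraftWeight l (suc n) j ≡ l ^ 3 * kraftWeight l n j
kraftWeight-suc l {n} {zero}  _   = refl
kraftWeight-suc l {n} {suc j} j<n = begin
  l * (l ^ 3) ^ (n ∸ j)                 ≡⟨ cong (λ m → l * (l ^ 3) ^ m) (+-∸-assoc 1 j<n) ⟩
  l * (l ^ 3 * (l ^ 3) ^ (n ∸ suc j))   ≡⟨ x*[y*z]≡y*[x*z] l (l ^ 3) _ ⟩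
  l ^ 3 * (l * (l ^ 3) ^ (n ∸ suc j))   ∎
  where
    open ≡-Reasoning
    x*[y*z]≡y*[x*z] : ∀ x y z → x * (y * z) ≡ y * (x * z)
    x*[y*z]≡y*[x*z] = solve-∀

sum-kraftWeight : (l n : ℕ) →
  sum (map (kraftWeight l n ∘ ∣_∣) (allSubsets n)) + l * (l ^ 3) ^ n ≡ (l ^ 3) ^ n + l * suc (l ^ 3) ^ n
sum-kraftWeight l zero    = refl
sum-kraftWeight l (suc n) = begin
  sum (map (kraftWeight l (suc n) ∘ ∣_∣) (allSubsets (suc n))) + l * N ^ suc n
    ≡⟨ cong (_+ l * N ^ suc n) (sum-allSubsets-suc {n} (kraftWeight l (suc n) ∘ ∣_∣)) ⟩
  sum (map (λ T → l * N ^ (n ∸ ∣ T ∣)) S) + sum (map (kraftWeight l (suc n) ∘ ∣_∣) S) + l * N ^ suc n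
    ≡⟨ cong₂ (λ u v → u + v + l * N ^ suc n)
             (trans (sum-map-*ˡ l _ S) (cong (l *_) (binomial-allSubsets N n)))
             (trans (cong sum (map-cong (λ T → kraftWeight-suc l (∣p∣≤n T)) S)) (sum-map-*ˡ N _ S)) ⟩
  l * suc N ^ n + N * W + l * (N * N ^ n)
    ≡⟨ regroup l N (N ^ n) W (suc N ^ n) ⟩
  l * suc N ^ n + N * (W + l * N ^ n)
    ≡⟨ cong (λ m → l * suc N ^ n + N * m) (sum-kraftWeight l n) ⟩
  l * suc N ^ n + N * (N ^ n + l * suc N ^ n)
    ≡⟨ expand l N (N ^ n) (suc N ^ n) ⟩
  N * N ^ n + l * (suc N * suc N ^ n)
    ∎
  where
    open ≡-Reasoning
    N : ℕ
    N = l ^ 3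
    S : List (Subset n)
    S = allSubsets n
    W : ℕ
    W = sum (map (kraftWeight l n ∘ ∣_∣) S)
    regroup : ∀ l N P W Q → l * Q + N * W + l * (N * P) ≡ l * Q + N * (W + l * P)
    regroup = solve-∀
    expand : ∀ l N P Q → l * Q + N * (P + l * Q) ≡ N * P + l * (suc N * Q)
    expand = solve-∀

bernoulli : (N n : ℕ) → suc N ^ n * N ≤ N * N ^ n + n * suc N ^ n
bernoulli N zero    = ≤-reflexive (identity N)
  where
    identity : ∀ N → 1 * N ≡ N * 1 + 0
    identity = solve-∀
bernoulli N (suc n) = begin
  suc N * X * N                              ≡⟨ *-assoc (suc N) X N ⟩
  suc N * (X * N)                            ≤⟨ *-monoʳ-≤ (suc N) (bernoulli N n) ⟩
  suc N * (N * P + n * X)                    ≡⟨ expand N P X n ⟩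
  N * (N * P) + (N * P + n * (suc N * X))
    ≤⟨ +-monoʳ-≤ (N * (N * P)) (+-monoˡ-≤ _ (^-monoˡ-≤ (suc n) (n≤1+n N))) ⟩
  N * (N * P) + (suc N * X + n * (suc N * X)) ≡⟨⟩
  N * (N * P) + suc n * (suc N * X)          ∎
  where
    open ≤-Reasoning
    P X : ℕ
    P = N ^ n
    X = suc N ^ n
    expand : ∀ N P X n → suc N * (N * P + n * X) ≡ N * (N * P) + (N * P + n * (suc N * X))
    expand = solve-∀

[1+N]^n≤2*N^n : ∀ N n .{{_ : NonZero N}} → 2 * n ≤ N → suc N ^ n ≤ 2 * N ^ n
[1+N]^n≤2*N^n N n 2n≤N = *-cancelˡ-≤ N (+-cancelʳ-≤ (N * X) (N * X) (N * (2 * P)) (begin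
  N * X + N * X              ≡⟨ double N X ⟩
  2 * (X * N)                ≤⟨ *-monoʳ-≤ 2 (bernoulli N n) ⟩
  2 * (N * P + n * X)        ≡⟨ distribute N P X n ⟩
  N * (2 * P) + 2 * n * X    ≤⟨ +-monoʳ-≤ (N * (2 * P)) (*-monoˡ-≤ X 2n≤N) ⟩
  N * (2 * P) + N * X        ∎))
  where
    open ≤-Reasoning
    P X : ℕ
    P = N ^ n
    X = suc N ^ n
    double : ∀ N X → N * X + N * X ≡ 2 * (X * N)
    double = solve-∀
    distribute : ∀ N P X n → 2 * (N * P + n * X) ≡ N * (2 * P) + 2 * n * X
    distribute = solve-∀

kraftSum-bound : ∀ m n → 2 * suc m * n ≤ m * suc m ^ 3 → kraftSum (suc m) n ≤ suc m ^ (3 * n + 1)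
kraftSum-bound m n hyp = begin
  kraftSum l n       ≡⟨ cong sum (map-cong (λ T → l^[3n+1∸cost]≡kraftWeight l (∣p∣≤n T)) (allSubsets n)) ⟩
  W                  ≤⟨ +-cancelʳ-≤ (l * P) W (l * P) (begin
    W + l * P          ≡⟨ sum-kraftWeight l n ⟩
    P + l * X          ≤⟨ *-cancelˡ-≤ N times-N ⟩
    l * P + l * P      ∎) ⟩
  l * P              ≡⟨ l*[l^3]^n≡l^[3n+1] ⟩
  l ^ (3 * n + 1)    ∎
  where
    open ≤-Reasoning
    l N P X W : ℕ
    l = suc m
    N = l ^ 3
    P = N ^ n
    X = suc N ^ n
    W = sum (map (kraftWeight l n ∘ ∣_∣) (allSubsets n))
    e₀ : ∀ l n → l * (2 * n) ≡ 2 * l * n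
    e₀ = solve-∀
    2n≤N : 2 * n ≤ N
    2n≤N = *-cancelˡ-≤ l (begin
      l * (2 * n)  ≡⟨ e₀ l n ⟩
      2 * l * n    ≤⟨ hyp ⟩
      m * N        ≤⟨ *-monoˡ-≤ N (n≤1+n m) ⟩
      l * N        ∎)
    times-N : N * (P + l * X) ≤ N * (l * P + l * P)
    times-N = begin
      N * (P + l * X)                          ≡⟨ e₁ N P l X ⟩
      N * P + l * (X * N)                      ≤⟨ +-monoʳ-≤ (N * P) (*-monoʳ-≤ l (bernoulli N n)) ⟩
      N * P + l * (N * P + n * X)              ≡⟨ e₂ N P l n X ⟩
      N * P + l * (N * P) + l * n * X
        ≤⟨ +-monoʳ-≤ (N * P + l * (N * P)) (*-monoʳ-≤ (l * n) ([1+N]^n≤2*N^n N n 2n≤N)) ⟩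
      N * P + l * (N * P) + l * n * (2 * P)    ≡⟨ e₃ N P l n ⟩
      N * P + l * (N * P) + 2 * l * n * P      ≤⟨ +-monoʳ-≤ (N * P + l * (N * P)) (*-monoˡ-≤ P hyp) ⟩
      N * P + l * (N * P) + m * N * P          ≡⟨ e₄ N P m ⟩
      N * (suc m * P + suc m * P)              ∎
      where
        e₁ : ∀ N P l X → N * (P + l * X) ≡ N * P + l * (X * N)
        e₁ = solve-∀
        e₂ : ∀ N P l n X → N * P + l * (N * P + n * X) ≡ N * P + l * (N * P) + l * n * X
        e₂ = solve-∀
        e₃ : ∀ N P l n → N * P + l * (N * P) + l * n * (2 * P) ≡ N * P + l * (N * P) + 2 * l * n * P
        e₃ = solve-∀
        e₄ : ∀ N P m → N * P + suc m * (N * P) + m * N * P ≡ N * (suc m * P + suc m * P)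
        e₄ = solve-∀
    l*[l^3]^n≡l^[3n+1] : l * P ≡ l ^ (3 * n + 1)
    l*[l^3]^n≡l^[3n+1] = begin-equality
      l * (l ^ 3) ^ n      ≡⟨ cong (l *_) (^-*-assoc l 3 n) ⟩
      l * l ^ (3 * n)      ≡⟨ *-comm l _ ⟩
      l ^ (3 * n) * l      ≡⟨ cong (l ^ (3 * n) *_) (*-identityʳ l) ⟨
      l ^ (3 * n) * l ^ 1  ≡⟨ ^-distribˡ-+-* l (3 * n) 1 ⟨
      l ^ (3 * n + 1)      ∎

-- Paving matroids of rank 3

AllPairs-restrict : {P : A → Set} {R S : A → A → Set} → (∀ {x y} → P x → P y → R x y → S x y) →
  {xs : List A} → All P xs → AllPairs R xs → AllPairs S xs
AllPairs-restrict f []       []           = []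
AllPairs-restrict f (p ∷ ps) (rs ∷ rss) = All.zipWith (λ (q , r) → f p q r) (ps , rs) ∷ AllPairs-restrict f ps rss

Separated : List A → List A → Set
Separated I J = ∃[ x ] ((x ∈ I × x ∉ J) ⊎ (x ∉ I × x ∈ J))

sublists-⊆ : {I xs : List A} {x : A} → I ∈ sublists xs → x ∈ I → x ∈ xs
sublists-⊆ {xs = []}     (here refl) ()
sublists-⊆ {xs = y ∷ xs} I∈ x∈I with ∈-++⁻ (map (y ∷_) (sublists xs)) I∈
... | inj₂ I∈′ = there (sublists-⊆ I∈′ x∈I)
... | inj₁ I∈y∷ with ∈-map⁻ (y ∷_) I∈y∷
...   | I′ , I′∈ , refl with x∈I
...     | here x≡y    = here x≡y
...     | there x∈I′  = there (sublists-⊆ I′∈ x∈I′)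

sublists-separated : {xs : List A} → Unique xs → AllPairs Separated (sublists xs)
sublists-separated {xs = []}     _ = [] ∷ []
sublists-separated {xs = y ∷ xs} u@(_ ∷ u′) =
  AllPairs.++⁺ (AllPairs.map⁺ (AllPairs-restrict cons-separated (All.tabulate (λ I∈ → sublists-⊆ I∈))
                                                                 (sublists-separated u′)))
               (sublists-separated u′)
               (All.map⁺ (All.tabulate λ _ → All.tabulate λ J∈ → y , inj₁ (here refl , y∉xs ∘ sublists-⊆ J∈)))
  where
    y∉xs : y ∉ xs
    y∉xs = Unique.Unique[x∷xs]⇒x∉xs u
    cons-separated : {I J : List _} → (∀ {x} → x ∈ I → x ∈ xs) → (∀ {x} → x ∈ J → x ∈ xs) →
      Separated I J → Separated (y ∷ I) (y ∷ J)
    cons-separated I⊆ J⊆ (x , inj₁ (x∈I , x∉J)) =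
      x , inj₁ (there x∈I , λ { (here refl) → y∉xs (I⊆ x∈I) ; (there x∈J) → x∉J x∈J })
    cons-separated I⊆ J⊆ (x , inj₂ (x∉I , x∈J)) =
      x , inj₂ ((λ { (here refl) → y∉xs (J⊆ x∈J) ; (there x∈I) → x∉I x∈I }) , there x∈J)

eqSub-refl : (X : Subset n) → T (eqSub X X)
eqSub-refl []          = _
eqSub-refl (true  ∷ X) = eqSub-refl X
eqSub-refl (false ∷ X) = eqSub-refl X

eqSub⇒≡ : (X Y : Subset n) → T (eqSub X Y) → X ≡ Y
eqSub⇒≡ []          []          _ = refl
eqSub⇒≡ (true  ∷ X) (true  ∷ Y) e = cong (true ∷_) (eqSub⇒≡ X Y e)
eqSub⇒≡ (false ∷ X) (false ∷ Y) e = cong (false ∷_) (eqSub⇒≡ X Y e)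

memB⇒∈ : {X : Subset n} (I : List (Subset n)) → T (memB X I) → X ∈ I
memB⇒∈ {X = X} I = Any.map (eqSub⇒≡ X _) ∘ any⁻ _ I

∈⇒memB : {X : Subset n} {I : List (Subset n)} → X ∈ I → T (memB X I)
∈⇒memB {X = X} = any⁺ _ ∘ Any.map (λ { refl → eqSub-refl X })

record IsPavingRank3 (I : List (Subset n)) : Set where
  field
    augment : ∀ {X Y} → X ∈ I → Y ∈ I → suc ∣ X ∣ ≤ ∣ Y ∣ →
              ∃[ x ] lookup Y x ≡ true × lookup X x ≡ false × X ∪ ⁅ x ⁆ ∈ I
    rank≤3  : ∀ {X} → X ∈ I → ∣ X ∣ ≤ 3
    paving  : ∀ X → ∣ X ∣ ≤ 2 → X ∈ I

isPavingRank3B-sound : (I : List (Subset n)) → T (isPavingRank3B I) → IsPavingRank3 I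
isPavingRank3B-sound {n} I valid = record { augment = augment ; rank≤3 = rank≤3 ; paving = paving }
  where
    split : ∀ u {v} → T (u ∧ v) → T u × T v
    split _ = Equivalence.to T-∧
    implies : ∀ {u v} → T (not u ∨ v) → T u → T v
    implies {true} v _ = v
    matroid : T (isMatroidB I)
    matroid = proj₁ (split (isMatroidB I) valid)
    rank3 : T (rank3B I)
    rank3 = proj₁ (split (rank3B I) (proj₂ (split (isMatroidB I) valid)))
    paving3 : T (paving3B I)
    paving3 = proj₂ (split (rank3B I) (proj₂ (split (isMatroidB I) valid)))
    augmentable : T (augmentB I)
    augmentable = proj₂ (split (hereditaryB I) (proj₂ (split (memB (emptySet n) I) matroid)))
    augment : ∀ {X Y} → X ∈ I → Y ∈ I → suc ∣ X ∣ ≤ ∣ Y ∣ →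
              ∃[ x ] lookup Y x ≡ true × lookup X x ≡ false × X ∪ ⁅ x ⁆ ∈ I
    augment {X} {Y} X∈ Y∈ larger
      with Any.satisfied (any⁻ _ (allFin n)
             (implies (All.lookup (all⁺ _ I (All.lookup (all⁺ _ I augmentable) X∈)) Y∈) (≤⇒≤ᵇ larger)))
    ... | x , witness with split (lookup Y x) witness
    ...   | x∈Y , rest with split (not (lookup X x)) rest
    ...     | x∉X , X∪x∈ = x , Equivalence.to T-≡ x∈Y , Equivalence.to T-not-≡ x∉X , memB⇒∈ I X∪x∈
    rank≤3 : ∀ {X} → X ∈ I → ∣ X ∣ ≤ 3
    rank≤3 X∈ = ≤ᵇ⇒≤ _ 3 (All.lookup (all⁺ _ I (proj₁ (split (all (λ A → ∣ A ∣ ≤ᵇ 3) I) rank3))) X∈)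
    paving : ∀ X → ∣ X ∣ ≤ 2 → X ∈ I
    paving X small =
      memB⇒∈ I (implies (All.lookup (all⁺ _ (allSubsets n) paving3) (allSubsets-complete X)) (≤⇒≤ᵇ small))

dependent : List (Subset n) → Ternary n
dependent I x y z = not (memB (triple x y z) I)

∈⇒not-memB≡false : {X : Subset n} {I : List (Subset n)} → X ∈ I → not (memB X I) ≡ false
∈⇒not-memB≡false X∈I = cong not (Equivalence.to T-≡ (∈⇒memB X∈I))

∉⇒not-memB≡true : {X : Subset n} (I : List (Subset n)) → X ∉ I → not (memB X I) ≡ true
∉⇒not-memB≡true {X = X} I X∉I with memB X I in X∈?
... | false = refl
... | true  = ⊥-elim (X∉I (memB⇒∈ I (Equivalence.from T-≡ X∈?)))

module PavingMatroid {I : List (Subset n)} (isPaving : IsPavingRank3 I) where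
  open IsPavingRank3 isPaving

  augment-pair : ∀ {a b c d} → a ≢ b → a ≢ c → a ≢ d → c ≢ d → triple a c d ∈ I →
    ∃[ x ] x ≢ a × lookup (triple a c d) x ≡ true × dependent I a b x ≡ false
  augment-pair {a} {b} a≢b a≢c a≢d c≢d acd∈I
    with augment (paving (⁅ a ⁆ ∪ ⁅ b ⁆) (≤-reflexive (card-pair a≢b))) acd∈I
                 (≤-reflexive (trans (cong suc (card-pair a≢b)) (sym (card-triple a≢c a≢d c≢d))))
  ... | x , x∈acd , x∉ab , abx∈I =
    x , ∉⁅⁆∪⇒≢ ⁅ b ⁆ x∉ab , x∈acd , ∈⇒not-memB≡false (subst (_∈ I) (∪-assoc ⁅ a ⁆ ⁅ b ⁆ ⁅ x ⁆) abx∈I)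

  dependent-exchange : ∀ {a b c d} → a ≢ b → a ≢ c → a ≢ d → b ≢ c → b ≢ d → c ≢ d →
    dependent I a b c ≡ true → dependent I a b d ≡ true → dependent I a c d ≡ true
  dependent-exchange {a} {b} {c} {d} a≢b a≢c a≢d _ _ c≢d abc abd with memB (triple a c d) I in acd
  ... | false = refl
  ... | true with augment-pair {b = b} a≢b a≢c a≢d c≢d (memB⇒∈ I (Equivalence.from T-≡ acd))
  ...   | x , x≢a , x∈acd , abx with toSum (x ≟ c) | toSum (x ≟ d)
  ...     | inj₁ refl | _         = ⊥-elim (true≢false (trans (sym abc) abx))
  ...     | inj₂ _    | inj₁ refl = ⊥-elim (true≢false (trans (sym abd) abx))
  ...     | inj₂ x≢c  | inj₂ x≢d  = ⊥-elim (true≢false (trans (sym x∈acd) (∉triple x≢a x≢c x≢d)))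

  dependent-isLinearSpace : IsLinearSpace (dependent I)
  dependent-isLinearSpace = record
    { sym₁₂    = λ x y z → cong (λ S → not (memB S I)) (triple-swap₁₂ x y z)
    ; sym₂₃    = λ x y z → cong (λ S → not (memB S I)) (triple-swap₂₃ x y z)
    ; exchange = dependent-exchange
    }

independent-vs-dependent : {I J : List (Subset n)} → IsPavingRank3 I → IsPavingRank3 J →
  {X : Subset n} → X ∈ I → X ∉ J → Differ (dependent I) (dependent J)
independent-vs-dependent {J = J} isI isJ {X} X∈I X∉J
  with card≡3⇒triple X (≤-antisym (IsPavingRank3.rank≤3 isI X∈I) (≰⇒> (X∉J ∘ IsPavingRank3.paving isJ X)))
... | x , y , z , x≢y , x≢z , y≢z , refl =
  x , y , z , x≢y , x≢z , y≢z ,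
  λ same → true≢false (trans (sym (∉⇒not-memB≡true J X∉J)) (trans (sym same) (∈⇒not-memB≡false X∈I)))

separated⇒Differ : {I J : List (Subset n)} → IsPavingRank3 I → IsPavingRank3 J →
  Separated I J → Differ (dependent I) (dependent J)
separated⇒Differ isI isJ (_ , inj₁ (X∈I , X∉J)) = independent-vs-dependent isI isJ X∈I X∉J
separated⇒Differ isI isJ (_ , inj₂ (X∉I , X∈J)) with independent-vs-dependent isJ isI X∈J X∉I
... | x , y , z , x≢y , x≢z , y≢z , differ = x , y , z , x≢y , x≢z , y≢z , differ ∘ sym

pavingMatroids : (n : ℕ) → List (List (Subset n))
pavingMatroids n = filter (λ I → T? (isPavingRank3B I)) (sublists (allSubsets n))

pavingMatroids-sound : (n : ℕ) → All IsPavingRank3 (pavingMatroids n)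
pavingMatroids-sound n =
  All.map (isPavingRank3B-sound _) (All.all-filter (λ I → T? (isPavingRank3B I)) (sublists (allSubsets n)))

p3≤ : ∀ m n → 2 * suc m * n ≤ m * suc m ^ 3 → p3 n ≤ suc m ^ (n C 2)
p3≤ m n condition = subst (_≤ suc m ^ (n C 2)) (length-map dependent (pavingMatroids n))
  (Counting.linearSpaces-bound (suc m) (kraftSum-bound m n condition) (map dependent (pavingMatroids n))
    (All.map⁺ (All.map PavingMatroid.dependent-isLinearSpace (pavingMatroids-sound n)))
    (AllPairs.map⁺ (AllPairs-restrict separated⇒Differ (pavingMatroids-sound n)
      (AllPairs.filter⁺ (λ I → T? (isPavingRank3B I)) (sublists-separated (allSubsets-unique n))))))

-- The asymptotic bound

2*[1+n]C2≡[1+n]*n : ∀ n → 2 * (suc n C 2) ≡ suc n * n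
2*[1+n]C2≡[1+n]*n zero    = refl
2*[1+n]C2≡[1+n]*n (suc n) = begin
  2 * ((2 + n) C 2)                   ≡⟨ cong (2 *_) (nCk+nC[k+1]≡[n+1]C[k+1] (suc n) 1) ⟨
  2 * ((1 + n) C 1 + (1 + n) C 2)     ≡⟨ cong (λ a → 2 * (a + (1 + n) C 2)) (nC1≡n (suc n)) ⟩
  2 * ((1 + n) + (1 + n) C 2)         ≡⟨ *-distribˡ-+ 2 (suc n) _ ⟩
  2 * (1 + n) + 2 * ((1 + n) C 2)     ≡⟨ cong (2 * suc n +_) (2*[1+n]C2≡[1+n]*n n) ⟩
  2 * (1 + n) + (1 + n) * n           ≡⟨ e n ⟩
  (2 + n) * (1 + n)                   ∎
  where
    open ≡-Reasoning
    e : ∀ n → 2 * (1 + n) + (1 + n) * n ≡ (2 + n) * (1 + n)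
    e = solve-∀

nC2*[n∸2]≡3*nC3 : ∀ n → (n C 2) * (n ∸ 2) ≡ 3 * (n C 3)
nC2*[n∸2]≡3*nC3 zero                = refl
nC2*[n∸2]≡3*nC3 (suc zero)          = refl
nC2*[n∸2]≡3*nC3 (suc (suc zero))    = refl
nC2*[n∸2]≡3*nC3 (suc (suc (suc k))) = begin
  ((3 + k) C 2) * (1 + k)              ≡⟨ cong (_* suc k) (nCk+nC[k+1]≡[n+1]C[k+1] (2 + k) 1) ⟨
  ((2 + k) C 1 + P) * (1 + k)          ≡⟨ cong (λ a → (a + P) * suc k) (nC1≡n (2 + k)) ⟩
  ((2 + k) + P) * (1 + k)              ≡⟨ e₁ k P ⟩
  (2 + k) * (1 + k) + P + P * k        ≡⟨ cong (λ a → a + P + P * k) (2*[1+n]C2≡[1+n]*n (suc k)) ⟨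
  2 * P + P + P * k                    ≡⟨ cong (2 * P + P +_) (nC2*[n∸2]≡3*nC3 (suc (suc k))) ⟩
  2 * P + P + 3 * ((2 + k) C 3)        ≡⟨ e₂ P ((2 + k) C 3) ⟩
  3 * (P + (2 + k) C 3)                ≡⟨ cong (3 *_) (nCk+nC[k+1]≡[n+1]C[k+1] (2 + k) 2) ⟩
  3 * ((3 + k) C 3)                    ∎
  where
    open ≡-Reasoning
    P : ℕ
    P = (2 + k) C 2
    e₁ : ∀ k P → ((2 + k) + P) * (1 + k) ≡ (2 + k) * (1 + k) + P + P * k
    e₁ = solve-∀
    e₂ : ∀ P Q → 2 * P + P + 3 * Q ≡ 3 * (P + Q)
    e₂ = solve-∀

^-distrib-* : ∀ a b c → (a * b) ^ c ≡ a ^ c * b ^ c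
^-distrib-* a b zero    = refl
^-distrib-* a b (suc c) = trans (cong (a * b *_) (^-distrib-* a b c)) (e a b (a ^ c) (b ^ c))
  where
    e : ∀ a b x y → a * b * (x * y) ≡ a * x * (b * y)
    e = solve-∀

power-bound : ∀ b l n {p} → p ≤ l ^ (n C 2) → b ^ (n C 3) * p ^ (n ∸ 2) ≤ (b * l ^ 3) ^ (n C 3)
power-bound b l n {p} p≤ = begin
  b ^ (n C 3) * p ^ (n ∸ 2)                ≤⟨ *-monoʳ-≤ (b ^ (n C 3)) (^-monoˡ-≤ (n ∸ 2) p≤) ⟩
  b ^ (n C 3) * (l ^ (n C 2)) ^ (n ∸ 2)    ≡⟨ cong (b ^ (n C 3) *_) (^-*-assoc l (n C 2) (n ∸ 2)) ⟩
  b ^ (n C 3) * l ^ ((n C 2) * (n ∸ 2))    ≡⟨ cong (λ e → b ^ (n C 3) * l ^ e) (nC2*[n∸2]≡3*nC3 n) ⟩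
  b ^ (n C 3) * l ^ (3 * (n C 3))          ≡⟨ cong (b ^ (n C 3) *_) (^-*-assoc l 3 (n C 3)) ⟨
  b ^ (n C 3) * (l ^ 3) ^ (n C 3)          ≡⟨ ^-distrib-* b (l ^ 3) (n C 3) ⟨
  (b * l ^ 3) ^ (n C 3)                    ∎
  where open ≤-Reasoning

crossing : (g : ℕ → ℕ) {X : ℕ} → g 0 ≤ X → ∀ k → X < g k → ∃[ t ] g t ≤ X × X < g (suc t)
crossing g g0≤X zero    X<g0 = ⊥-elim (<⇒≱ X<g0 g0≤X)
crossing g {X} g0≤X (suc k) X<g with X <? g k
... | yes X<gk = crossing g g0≤X k X<gk
... | no  X≮gk = k , ≮⇒≥ X≮gk , X<g

n<2*[20+n]³ : ∀ n → n < 2 * suc (19 + n) ^ 3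
n<2*[20+n]³ n = begin-strict
  n                       <⟨ m<n+m n {20} (s≤s z≤n) ⟩
  suc (19 + n)            ≤⟨ m≤m*n (suc (19 + n)) (suc (19 + n) ^ 2) ⟩
  suc (19 + n) ^ 3        ≤⟨ m≤m+n _ _ ⟩
  2 * suc (19 + n) ^ 3    ∎
  where open ≤-Reasoning

cube-bound⇒kraft-condition : ∀ t n → 5 * n < 2 * suc (suc (19 + t)) ^ 3 →
  2 * suc (19 + t) * n ≤ (19 + t) * suc (19 + t) ^ 3
cube-bound⇒kraft-condition t n 5n<2[m+2]³ = *-cancelˡ-≤ 5 (begin
  5 * (2 * suc m * n)                     ≡⟨ e₁ (suc m) n ⟩
  2 * suc m * (5 * n)                     ≤⟨ *-monoʳ-≤ (2 * suc m) (<⇒≤ 5n<2[m+2]³) ⟩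
  2 * suc m * (2 * suc (suc m) ^ 3)       ≡⟨ e₂ (suc m) (suc (suc m) ^ 3) ⟩
  suc m * (4 * suc (suc m) ^ 3)           ≤⟨ *-monoʳ-≤ (suc m) 4[m+2]³≤5m[m+1]² ⟩
  suc m * (5 * m * suc m ^ 2)             ≡⟨ e₃ (suc m) m ⟩
  5 * (m * suc m ^ 3)                     ∎)
  where
    open ≤-Reasoning
    m : ℕ
    m = 19 + t
    e₁ : ∀ l n → 5 * (2 * l * n) ≡ 2 * l * (5 * n)
    e₁ = solve-∀
    e₂ : ∀ l W → 2 * l * (2 * W) ≡ l * (4 * W)
    e₂ = solve-∀
    e₃ : ∀ l m → l * (5 * m * (l * (l * 1))) ≡ 5 * (m * (l * (l * (l * 1))))
    e₃ = solve-∀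
    expand : ∀ t → 5 * (19 + t) * (suc (19 + t) * (suc (19 + t) * 1)) ≡
                   4 * (suc (suc (19 + t)) * (suc (suc (19 + t)) * (suc (suc (19 + t)) * 1)))
                   + (956 + 508 * t + 43 * t * t + t * t * t)
    expand = solve-∀
    4[m+2]³≤5m[m+1]² : 4 * suc (suc m) ^ 3 ≤ 5 * m * suc m ^ 2
    4[m+2]³≤5m[m+1]² = subst (4 * suc (suc m) ^ 3 ≤_) (sym (expand t)) (m≤m+n _ _)

-- m + 1 is the largest l ≥ 20 with 2 l³ ≤ 5 n.  The crossing is destructured with let:
-- abstracting it with `with` makes the type checker normalise the cubes and run out of memory.
choose-base : ∀ {n} → 3200 ≤ n → ∃[ m ] 2 * suc m * n ≤ m * suc m ^ 3 × 2 * suc m ^ 3 ≤ 5 * n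
choose-base {n} 3200≤n =
  let t , lower , upper =
        crossing (λ t → 2 * suc (19 + t) ^ 3) (*-monoʳ-≤ 5 3200≤n) (5 * n) (n<2*[20+n]³ (5 * n))
  in 19 + t , cube-bound⇒kraft-condition t n (subst (λ k → 5 * n < 2 * suc k ^ 3) (+-suc 19 t) upper) , lower

theorem16 : Σ ℕ λ a → Σ ℕ λ b → Σ ℕ λ K →
    (a * (K !) < b * eNum K) ×
    Σ ℕ λ N → ∀ n → N ≤ n →
      b ^ (n C 3) * p3 n ^ (n ∸ 2) ≤ (a * n) ^ (n C 3)
theorem16 = 5 , 2 , 3 , n≤1+n 31 , 3200 , bound
  where
    bound : ∀ n → 3200 ≤ n → 2 ^ (n C 3) * p3 n ^ (n ∸ 2) ≤ (5 * n) ^ (n C 3)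
    bound n 3200≤n =
      let m , condition , 2l³≤5n = choose-base 3200≤n
      in ≤-trans (power-bound 2 (suc m) n (p3≤ m n condition)) (^-monoˡ-≤ (n C 3) 2l³≤5n)
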